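{- Let $c_{n,m}$ denote the number of increasing 1,2-trees with $n$ vertices and $m$ edges. Then for all $n \geq 2$ and all integers $m$, \[ c_{n,m} = (n-1)\, c_{n-1,m-1} + (m-2)\, c_{n-1,m-2}, \] with initial conditions $c_{1,0}=1$ and $c_{1,k}=0$ for $k\neq 0$.
   Context: Increasing 1,2-trees are labeled graphs defined inductively: the only increasing 1,2-tree with one vertex is the isolated vertex labeled $1$; given an increasing 1,2-tree $T$ with $n$ vertices (labeled $1,\dots,n$), one obtains an increasing 1,2-tree with $n+1$ vertices by choosing either a vertex of $T$ or an edge of $T$ and adding a new vertex labeled $n+1$ adjacent to the chosen vertex, respectively to both endpoints of the chosen edge. Two increasing 1,2-trees are the same if they are equal as labeled graphs. -}

module Defs where

open import Data.Nat using (ℕ; zero; suc; _<_; _<?_)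
open import Data.Bool using (Bool; true; false; if_then_else_)
import Data.Bool.Properties as BoolP
open import Data.Fin using (Fin; toℕ; _≟_)
open import Data.Vec using (Vec; []; _∷_; _∷ʳ_; zipWith; lookup; replicate; _[_]≔_)
import Data.Vec.Properties as VecP
open import Data.List using (List; []; _∷_; [_]; map; concatMap; filter; length; deduplicate; _++_; allFin; cartesianProduct)
open import Data.Product using (_×_; _,_; proj₁; proj₂)
open import Relation.Nullary using (Dec; yes; no)
open import Relation.Nullary.Decidable using (does)
open import Relation.Binary.PropositionalEquality using (_≡_)
open import Data.Integer using (ℤ; +_)
import Data.Integer.Properties as ℤP

-- A labeled simple graph on n vertices, given by its adjacency matrix.
-- Index i : Fin n stands for the vertex labeled (toℕ i + 1).
Graph : ℕ → Set
Graph n = Vec (Vec Bool n) n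

graph-≟ : ∀ {n} (G H : Graph n) → Dec (G ≡ H)
graph-≟ = VecP.≡-dec (VecP.≡-dec BoolP._≟_)

adj : ∀ {n} → Graph n → Fin n → Fin n → Bool
adj G i j = lookup (lookup G i) j

edges : ∀ {n} → Graph n → List (Fin n × Fin n)
edges {n} G = filter (λ p → toℕ (proj₁ p) <? toℕ (proj₂ p))
                (filter (λ p → adj G (proj₁ p) (proj₂ p) BoolP.≟ true)
                   (cartesianProduct (allFin n) (allFin n)))

numEdges : ∀ {n} → Graph n → ℕ
numEdges G = length (edges G)

addVertex : ∀ {n} → Graph n → Vec Bool n → Graph (suc n)
addVertex G S = zipWith (λ row b → row ∷ʳ b) G S ∷ʳ (S ∷ʳ false)

single : ∀ {n} → Fin n → Vec Bool n
single i = replicate _ false [ i ]≔ true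

pair : ∀ {n} → Fin n → Fin n → Vec Bool n
pair i j = (replicate _ false [ i ]≔ true) [ j ]≔ true

grow : ∀ {n} → Graph n → List (Graph (suc n))
grow {n} G = map (λ v → addVertex G (single v)) (allFin n)
          ++ map (λ e → addVertex G (pair (proj₁ e) (proj₂ e))) (edges G)

-- All increasing 1,2-trees with n vertices (as labeled graphs, with
-- repetitions possibly coming from different construction sequences).
incTreesRaw : (n : ℕ) → List (Graph n)
incTreesRaw zero = []
incTreesRaw (suc zero) = [ (false ∷ []) ∷ [] ]
incTreesRaw (suc (suc k)) = concatMap grow (incTreesRaw (suc k))

incTrees : (n : ℕ) → List (Graph n)
incTrees n = deduplicate graph-≟ (incTreesRaw n)

c : ℕ → ℤ → ℕ
c n m = length (filter (λ G → (+ numEdges G) ℤP.≟ m) (incTrees n))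

-- A graph built by the construction determines its parent (delete the last
-- vertex) and the neighbourhood of its last vertex, so every increasing
-- 1,2-tree arises exactly once and no deduplication happens.  A parent on n
-- vertices with e edges has n children with e + 1 edges (attach to a vertex)
-- and e children with e + 2 edges (attach to an edge).  Summing over parents,
-- the second kind contributes e = m - 2 for each parent with m - 2 edges,
-- which is why the coefficient of c(n-1, m-2) is m - 2.

module Submission where

open import Defs
open import Data.Nat using (ℕ; _≤_; _∸_)
open import Data.Integer using (ℤ; +_; _+_; _-_; _*_)
open import Data.Product using (_×_)
open import Relation.Binary.PropositionalEquality using (_≡_; _≢_)

open import Level using (Level)
open import Function using (_∘_)
open import Data.Empty using (⊥-elim)
open import Data.Bool using (Bool; true; false; _∧_)
import Data.Bool.Properties as Boolₚ
open import Data.Nat as ℕ using (zero; suc; z≤n; s≤s; _<_; _<?_)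
import Data.Nat.Properties as ℕₚ
import Data.Integer.Properties as ℤₚ
open import Data.Integer.Tactic.RingSolver using (solve-∀)
open import Data.Fin using (Fin; toℕ; inject₁; fromℕ) renaming (_≟_ to _≟ᶠ_)
import Data.Fin as Fin
open import Data.Fin.Properties using (toℕ-inject₁; toℕ-fromℕ; toℕ<n)
open import Data.Vec using (Vec; []; _∷_; _∷ʳ_; zipWith; lookup; replicate; _[_]≔_)
import Data.Vec.Properties as Vecₚ
open import Data.List using (List; []; _∷_; map; filter; length; _++_; tabulate; allFin; cartesianProduct; concatMap; deduplicate)
open import Data.List.Properties using (length-tabulate; filter-all; filter-reject)
open import Data.List.Relation.Unary.All as All using (All; []; _∷_)
open import Data.List.Relation.Unary.All.Properties using (all-filter)
open import Data.List.Relation.Unary.Any using (here; there)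
open import Data.List.Relation.Unary.Unique.Propositional using (Unique)
open import Data.List.Relation.Unary.AllPairs using ([]; _∷_)
import Data.List.Relation.Unary.Unique.Propositional.Properties as Unique
open import Data.List.Membership.Propositional using (_∈_)
open import Data.List.Membership.Propositional.Properties using (∈-map⁻; ∈-++⁻)
open import Data.Product using (_,_; proj₁; proj₂; ∃)
open import Data.Sum using (_⊎_; inj₁; inj₂)
open import Relation.Nullary using (yes; no; ¬_)
open import Relation.Nullary.Decidable using (does; dec-true; dec-false; does-⇔)
open import Relation.Unary using (Pred; Decidable)
open import Relation.Binary using (DecidableEquality)
open import Relation.Binary.PropositionalEquality using (refl; sym; trans; cong; cong₂; module ≡-Reasoning)
open import Function.Bundles using (mk⇔)
open import Algebra.Properties.CommutativeMonoid.Sum ℕₚ.+-0-commutativeMonoid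
  using (sum; sum-syntax; sum-cong-≗; sum-init-last; ∑-distrib-+; sum-replicate-zero)

private
  variable
    a p : Level
    A B : Set a
    n : ℕ

indicator : Bool → ℕ
indicator true  = 1
indicator false = 0

count : (A → Bool) → List A → ℕ
count f []       = 0
count f (x ∷ xs) = indicator (f x) ℕ.+ count f xs

module _ {P : Pred A p} (P? : Decidable P) where

  length-filter≡count : ∀ xs → length (filter P? xs) ≡ count (does ∘ P?) xs
  length-filter≡count []       = refl
  length-filter≡count (x ∷ xs) with does (P? x)
  ... | true  = cong suc (length-filter≡count xs)
  ... | false = length-filter≡count xs

  count-filter : ∀ f xs → count f (filter P? xs) ≡ count (λ x → does (P? x) ∧ f x) xs
  count-filter f []       = refl
  count-filter f (x ∷ xs) with does (P? x)
  ... | true  = cong (indicator (f x) ℕ.+_) (count-filter f xs)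
  ... | false = count-filter f xs

count-++ : ∀ (f : A → Bool) xs ys → count f (xs ++ ys) ≡ count f xs ℕ.+ count f ys
count-++ f []       ys = refl
count-++ f (x ∷ xs) ys =
  trans (cong (indicator (f x) ℕ.+_) (count-++ f xs ys)) (sym (ℕₚ.+-assoc (indicator (f x)) _ _))

count-map : ∀ (f : B → Bool) (g : A → B) xs → count f (map g xs) ≡ count (f ∘ g) xs
count-map f g []       = refl
count-map f g (x ∷ xs) = cong (indicator (f (g x)) ℕ.+_) (count-map f g xs)

count-const : ∀ (f : A → Bool) {b} xs → All (λ x → f x ≡ b) xs → count f xs ≡ length xs ℕ.* indicator b
count-const f []       []         = refl
count-const f (x ∷ xs) (fx≡b ∷ h) = cong₂ ℕ._+_ (cong indicator fx≡b) (count-const f xs h)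

count-tabulate : ∀ (f : A → Bool) (g : Fin n → A) → count f (tabulate g) ≡ ∑[ i < n ] indicator (f (g i))
count-tabulate {n = zero}  f g = refl
count-tabulate {n = suc n} f g = cong (indicator (f (g Fin.zero)) ℕ.+_) (count-tabulate f (g ∘ Fin.suc))

count-cartesianProduct : ∀ (f : A × B → Bool) (g : Fin n → A) ys →
  count f (cartesianProduct (tabulate g) ys) ≡ ∑[ i < n ] count (λ y → f (g i , y)) ys
count-cartesianProduct {n = zero}  f g ys = refl
count-cartesianProduct {n = suc n} f g ys = begin
  count f (map (g Fin.zero ,_) ys ++ cartesianProduct (tabulate (g ∘ Fin.suc)) ys)
    ≡⟨ count-++ f (map (g Fin.zero ,_) ys) _ ⟩
  count f (map (g Fin.zero ,_) ys) ℕ.+ count f (cartesianProduct (tabulate (g ∘ Fin.suc)) ys)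
    ≡⟨ cong₂ ℕ._+_ (count-map f (g Fin.zero ,_) ys) (count-cartesianProduct f (g ∘ Fin.suc) ys) ⟩
  count (λ y → f (g Fin.zero , y)) ys ℕ.+ ∑[ i < n ] count (λ y → f (g (Fin.suc i) , y)) ys
    ∎
  where open ≡-Reasoning

isEdge : Graph n → Fin n → Fin n → Bool
isEdge G i j = does (adj G i j Boolₚ.≟ true) ∧ does (toℕ i <? toℕ j)

numEdges≡∑isEdge : (G : Graph n) → numEdges G ≡ ∑[ i < n ] ∑[ j < n ] indicator (isEdge G i j)
numEdges≡∑isEdge {n} G = begin
  length (filter lt? (filter adj? pairs))
    ≡⟨ length-filter≡count lt? (filter adj? pairs) ⟩
  count (does ∘ lt?) (filter adj? pairs)
    ≡⟨ count-filter adj? _ pairs ⟩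
  count (λ e → isEdge G (proj₁ e) (proj₂ e)) pairs
    ≡⟨ count-cartesianProduct (λ e → isEdge G (proj₁ e) (proj₂ e)) (λ i → i) (allFin n) ⟩
  ∑[ i < n ] count (isEdge G i) (allFin n)
    ≡⟨ sum-cong-≗ (λ i → count-tabulate (isEdge G i) (λ j → j)) ⟩
  ∑[ i < n ] ∑[ j < n ] indicator (isEdge G i j)
    ∎
  where
  open ≡-Reasoning
  pairs = cartesianProduct (allFin n) (allFin n)
  adj? = λ (e : Fin n × Fin n) → adj G (proj₁ e) (proj₂ e) Boolₚ.≟ true
  lt?  = λ (e : Fin n × Fin n) → toℕ (proj₁ e) <? toℕ (proj₂ e)

lookup-∷ʳ-inject₁ : ∀ (xs : Vec A n) x i → lookup (xs ∷ʳ x) (inject₁ i) ≡ lookup xs i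
lookup-∷ʳ-inject₁ (y ∷ xs) x Fin.zero    = refl
lookup-∷ʳ-inject₁ (y ∷ xs) x (Fin.suc i) = lookup-∷ʳ-inject₁ xs x i

lookup-∷ʳ-fromℕ : ∀ (xs : Vec A n) x → lookup (xs ∷ʳ x) (fromℕ n) ≡ x
lookup-∷ʳ-fromℕ []       x = refl
lookup-∷ʳ-fromℕ (y ∷ xs) x = lookup-∷ʳ-fromℕ xs x

lookup-addVertex-inject₁ : ∀ (G : Graph n) S i → lookup (addVertex G S) (inject₁ i) ≡ lookup G i ∷ʳ lookup S i
lookup-addVertex-inject₁ G S i =
  trans (lookup-∷ʳ-inject₁ (zipWith _∷ʳ_ G S) _ i) (Vecₚ.lookup-zipWith _∷ʳ_ i G S)

does-≟true : ∀ b → does (b Boolₚ.≟ true) ≡ b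
does-≟true true  = refl
does-≟true false = refl

isEdge-addVertex-old : ∀ (G : Graph n) S i j → isEdge (addVertex G S) (inject₁ i) (inject₁ j) ≡ isEdge G i j
isEdge-addVertex-old G S i j
  rewrite lookup-addVertex-inject₁ G S i | lookup-∷ʳ-inject₁ (lookup G i) (lookup S i) j
        | toℕ-inject₁ i | toℕ-inject₁ j = refl

isEdge-addVertex-new : ∀ (G : Graph n) S i → isEdge (addVertex G S) (inject₁ i) (fromℕ n) ≡ lookup S i
isEdge-addVertex-new {n} G S i
  rewrite lookup-addVertex-inject₁ G S i | lookup-∷ʳ-fromℕ (lookup G i) (lookup S i)
        | toℕ-inject₁ i | toℕ-fromℕ n | dec-true (toℕ i <? n) (toℕ<n i) =
  trans (Boolₚ.∧-identityʳ _) (does-≟true (lookup S i))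

isEdge-fromℕ : ∀ (G : Graph (suc n)) j → isEdge G (fromℕ n) j ≡ false
isEdge-fromℕ {n} G j rewrite toℕ-fromℕ n | dec-false (n <? toℕ j) (ℕₚ.≤⇒≯ (ℕₚ.≤-pred (toℕ<n j))) =
  Boolₚ.∧-zeroʳ _

∑-zero : ∀ {f : Fin n → ℕ} → (∀ i → f i ≡ 0) → sum f ≡ 0
∑-zero {n} f≗0 = trans (sum-cong-≗ f≗0) (sum-replicate-zero n)

size : Vec Bool n → ℕ
size {n} S = ∑[ i < n ] indicator (lookup S i)

numEdges-addVertex : ∀ (G : Graph n) S → numEdges (addVertex G S) ≡ numEdges G ℕ.+ size S
numEdges-addVertex {n} G S = begin
  numEdges H
    ≡⟨ numEdges≡∑isEdge H ⟩
  ∑[ i < suc n ] ∑[ j < suc n ] edge i j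
    ≡⟨ sum-init-last (λ i → ∑[ j < suc n ] edge i j) ⟩
  ∑[ i < n ] ∑[ j < suc n ] edge (inject₁ i) j ℕ.+ ∑[ j < suc n ] edge (fromℕ n) j
    ≡⟨ cong₂ ℕ._+_ (sum-cong-≗ old-row) new-row ⟩
  ∑[ i < n ] (∑[ j < n ] indicator (isEdge G i j) ℕ.+ indicator (lookup S i)) ℕ.+ 0
    ≡⟨ ℕₚ.+-identityʳ _ ⟩
  ∑[ i < n ] (∑[ j < n ] indicator (isEdge G i j) ℕ.+ indicator (lookup S i))
    ≡⟨ ∑-distrib-+ (λ i → ∑[ j < n ] indicator (isEdge G i j)) (indicator ∘ lookup S) ⟩
  ∑[ i < n ] ∑[ j < n ] indicator (isEdge G i j) ℕ.+ size S
    ≡⟨ cong (ℕ._+ size S) (numEdges≡∑isEdge G) ⟨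
  numEdges G ℕ.+ size S
    ∎
  where
  open ≡-Reasoning
  H = addVertex G S
  edge = λ i j → indicator (isEdge H i j)
  old-row : ∀ i → ∑[ j < suc n ] edge (inject₁ i) j ≡ ∑[ j < n ] indicator (isEdge G i j) ℕ.+ indicator (lookup S i)
  old-row i = trans (sum-init-last (edge (inject₁ i)))
    (cong₂ ℕ._+_ (sum-cong-≗ (cong indicator ∘ isEdge-addVertex-old G S i))
                 (cong indicator (isEdge-addVertex-new G S i)))
  new-row : ∑[ j < suc n ] edge (fromℕ n) j ≡ 0
  new-row = ∑-zero (cong indicator ∘ isEdge-fromℕ H)

size-replicate-false : ∀ n → size (replicate n false) ≡ 0
size-replicate-false n = ∑-zero (λ i → cong indicator (Vecₚ.lookup-replicate {n = n} i false))

size-insert : ∀ (S : Vec Bool n) i → lookup S i ≡ false → size (S [ i ]≔ true) ≡ suc (size S)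
size-insert (.false ∷ S) Fin.zero    refl = refl
size-insert (b ∷ S)      (Fin.suc i) i∉S  =
  trans (cong (indicator b ℕ.+_) (size-insert S i i∉S)) (ℕₚ.+-suc (indicator b) _)

lookup-single-≢ : ∀ {i j : Fin n} → i ≢ j → lookup (single i) j ≡ false
lookup-single-≢ {n} i≢j =
  trans (Vecₚ.lookup∘update′ (i≢j ∘ sym) (replicate n false) true) (Vecₚ.lookup-replicate {n = n} _ false)

size-single : ∀ (i : Fin n) → size (single i) ≡ 1
size-single {n} i = trans (size-insert (replicate n false) i (Vecₚ.lookup-replicate i false))
                          (cong suc (size-replicate-false n))

size-pair : ∀ {i j : Fin n} → i ≢ j → size (pair i j) ≡ 2
size-pair {i = i} {j} i≢j = trans (size-insert (single i) j (lookup-single-≢ i≢j)) (cong suc (size-single i))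

-- Distinct construction sequences give distinct graphs

addVertex-injective : ∀ {G H : Graph n} {S T} → addVertex G S ≡ addVertex H T → G ≡ H × S ≡ T
addVertex-injective {G = G} {H} {S} {T} eq with Vecₚ.∷ʳ-injective _ _ eq
... | rows , lastRow = rows-injective G H S T rows , Vecₚ.∷ʳ-injectiveˡ S T lastRow
  where
  rows-injective : ∀ {m k} (G H : Vec (Vec Bool m) k) S T → zipWith _∷ʳ_ G S ≡ zipWith _∷ʳ_ H T → G ≡ H
  rows-injective []      []      []      []      _  = refl
  rows-injective (g ∷ G) (h ∷ H) (s ∷ S) (t ∷ T) eq with Vecₚ.∷-injective eq
  ... | g≡h , G≡H = cong₂ _∷_ (Vecₚ.∷ʳ-injectiveˡ g h g≡h) (rows-injective G H S T G≡H)

lookup-single-≡ : ∀ (i : Fin n) → lookup (single i) i ≡ true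
lookup-single-≡ {n} i = Vecₚ.lookup∘update i (replicate n false) true

single-injective : ∀ {i j : Fin n} → single i ≡ single j → i ≡ j
single-injective {i = i} {j} eq with i ≟ᶠ j
... | yes i≡j = i≡j
... | no  i≢j with trans (sym (lookup-single-≡ i)) (trans (cong (λ S → lookup S i) eq) (lookup-single-≢ (i≢j ∘ sym)))
...   | ()

lookup-pair-true : ∀ (i j k : Fin n) → lookup (pair i j) k ≡ true → k ≡ i ⊎ k ≡ j
lookup-pair-true i j k k∈ij with k ≟ᶠ j | k ≟ᶠ i
... | yes k≡j | _       = inj₂ k≡j
... | no  _   | yes k≡i = inj₁ k≡i
... | no  k≢j | no  k≢i
  with trans (sym k∈ij) (trans (Vecₚ.lookup∘update′ k≢j (single i) true) (lookup-single-≢ (k≢i ∘ sym)))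
...   | ()

lookup-pairˡ : ∀ (i j : Fin n) → lookup (pair i j) i ≡ true
lookup-pairˡ i j with i ≟ᶠ j
... | yes refl = Vecₚ.lookup∘update i (single i) true
... | no  i≢j  = trans (Vecₚ.lookup∘update′ i≢j (single i) true) (lookup-single-≡ i)

lookup-pairʳ : ∀ (i j : Fin n) → lookup (pair i j) j ≡ true
lookup-pairʳ i j = Vecₚ.lookup∘update j (single i) true

<⇒≢ : ∀ {i j : Fin n} → toℕ i < toℕ j → i ≢ j
<⇒≢ i<j refl = ℕₚ.<-irrefl refl i<j

Ordered : Fin n × Fin n → Set
Ordered (i , j) = toℕ i < toℕ j

-- Orientation matters: pair i j ≡ pair j i.
pair-injective : ∀ {e f : Fin n × Fin n} → Ordered e → Ordered f →
                 pair (proj₁ e) (proj₂ e) ≡ pair (proj₁ f) (proj₂ f) → e ≡ f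
pair-injective {e = i , j} {k , l} i<j k<l eq
  with lookup-pair-true k l i (trans (cong (λ S → lookup S i) (sym eq)) (lookup-pairˡ i j))
     | lookup-pair-true k l j (trans (cong (λ S → lookup S j) (sym eq)) (lookup-pairʳ i j))
... | inj₁ refl | inj₂ refl = refl
... | inj₁ refl | inj₁ refl = ⊥-elim (ℕₚ.<-irrefl refl i<j)
... | inj₂ refl | inj₂ refl = ⊥-elim (ℕₚ.<-irrefl refl i<j)
... | inj₂ refl | inj₁ refl = ⊥-elim (ℕₚ.<-asym i<j k<l)

single≢pair : ∀ (v : Fin n) {i j} → i ≢ j → single v ≢ pair i j
single≢pair v i≢j eq with trans (sym (size-single v)) (trans (cong size eq) (size-pair i≢j))
... | ()

edges-ordered : ∀ (G : Graph n) → All Ordered (edges G)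
edges-ordered {n} G = all-filter (λ e → toℕ (proj₁ e) <? toℕ (proj₂ e))
  (filter (λ e → adj G (proj₁ e) (proj₂ e) Boolₚ.≟ true) (cartesianProduct (allFin n) (allFin n)))

edges-unique : ∀ (G : Graph n) → Unique (edges G)
edges-unique {n} G =
  Unique.filter⁺ _ (Unique.filter⁺ _ (Unique.cartesianProduct⁺ (Unique.allFin⁺ n) (Unique.allFin⁺ n)))

map⁺-injectiveOn : ∀ {P : Pred A p} {f : A → B} → (∀ {x y} → P x → P y → f x ≡ f y → x ≡ y) →
                   ∀ {xs} → All P xs → Unique xs → Unique (map f xs)
map⁺-injectiveOn inj []         []           = []
map⁺-injectiveOn inj (px ∷ pxs) (x∉xs ∷ uxs) =
  notImage pxs x∉xs ∷ map⁺-injectiveOn inj pxs uxs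
  where
  notImage : ∀ {ys} → All _ ys → All (_ ≢_) ys → All (_ ≢_) (map _ ys)
  notImage []         []           = []
  notImage (py ∷ pys) (x≢y ∷ x≢ys) = (x≢y ∘ inj px py) ∷ notImage pys x≢ys

grow-unique : ∀ (G : Graph n) → Unique (grow G)
grow-unique {n} G = Unique.++⁺
  (Unique.map⁺ (single-injective ∘ proj₂ ∘ addVertex-injective) (Unique.allFin⁺ n))
  (map⁺-injectiveOn (λ o₁ o₂ → pair-injective o₁ o₂ ∘ proj₂ ∘ addVertex-injective) (edges-ordered G) (edges-unique G))
  disjoint
  where
  disjoint : ∀ {H} → ¬ (H ∈ map (λ v → addVertex G (single v)) (allFin n)
                      × H ∈ map (λ e → addVertex G (pair (proj₁ e) (proj₂ e))) (edges G))
  disjoint (H∈singles , H∈pairs) with ∈-map⁻ _ H∈singles | ∈-map⁻ _ H∈pairs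
  ... | v , _ , refl | e , e∈G , eq =
    single≢pair v (<⇒≢ (All.lookup (edges-ordered G) e∈G)) (proj₂ (addVertex-injective eq))

∈-grow⇒addVertex : ∀ (G : Graph n) {H} → H ∈ grow G → ∃ λ S → H ≡ addVertex G S
∈-grow⇒addVertex {n} G H∈ with ∈-++⁻ (map (λ v → addVertex G (single v)) (allFin n)) H∈
... | inj₁ H∈singles = let v , _ , eq = ∈-map⁻ _ H∈singles in single v , eq
... | inj₂ H∈pairs   = let e , _ , eq = ∈-map⁻ _ H∈pairs in pair (proj₁ e) (proj₂ e) , eq

∈-concatMap-grow : ∀ (L : List (Graph n)) {H} → H ∈ concatMap grow L → ∃ λ G → G ∈ L × ∃ λ S → H ≡ addVertex G S
∈-concatMap-grow (G ∷ L) H∈ with ∈-++⁻ (grow G) H∈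
... | inj₁ H∈G = G , here refl , ∈-grow⇒addVertex G H∈G
... | inj₂ H∈L = let G′ , G′∈L , rest = ∈-concatMap-grow L H∈L in G′ , there G′∈L , rest

concatMap-grow-unique : ∀ (L : List (Graph n)) → Unique L → Unique (concatMap grow L)
concatMap-grow-unique []      []          = []
concatMap-grow-unique (G ∷ L) (G∉L ∷ uL) = Unique.++⁺ (grow-unique G) (concatMap-grow-unique L uL) disjoint
  where
  disjoint : ∀ {H} → ¬ (H ∈ grow G × H ∈ concatMap grow L)
  disjoint (H∈G , H∈L) with ∈-grow⇒addVertex G H∈G | ∈-concatMap-grow L H∈L
  ... | _ , refl | G′ , G′∈L , _ , eq = All.lookup G∉L G′∈L (proj₁ (addVertex-injective eq))

incTreesRaw-unique : ∀ n → Unique (incTreesRaw n)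
incTreesRaw-unique zero          = []
incTreesRaw-unique (suc zero)    = [] ∷ []
incTreesRaw-unique (suc (suc n)) = concatMap-grow-unique (incTreesRaw (suc n)) (incTreesRaw-unique (suc n))

deduplicate-unique : ∀ (_≟_ : DecidableEquality A) {xs} → Unique xs → deduplicate _≟_ xs ≡ xs
deduplicate-unique _≟_ {[]}     []          = refl
deduplicate-unique _≟_ {x ∷ xs} (x∉xs ∷ uxs) rewrite deduplicate-unique _≟_ uxs = cong (x ∷_) (filter-all _ x∉xs)

incTrees≡incTreesRaw : ∀ n → incTrees n ≡ incTreesRaw n
incTrees≡incTreesRaw n = deduplicate-unique graph-≟ (incTreesRaw-unique n)

hasEdges : ℤ → Graph n → Bool
hasEdges m G = does (+ numEdges G ℤₚ.≟ m)

c≡count : ∀ n m → c n m ≡ count (hasEdges m) (incTreesRaw n)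
c≡count n m = trans (cong (length ∘ filter hasEdges?) (incTrees≡incTreesRaw n))
                    (length-filter≡count hasEdges? (incTreesRaw n))
  where
  hasEdges? = λ (G : Graph n) → + numEdges G ℤₚ.≟ m

hasEdges-shift : ∀ (G : Graph n) (H : Graph (suc n)) k m →
                 numEdges H ≡ numEdges G ℕ.+ k → hasEdges m H ≡ hasEdges (m - + k) G
hasEdges-shift G H k m eH = does-⇔ (mk⇔ to from) (+ numEdges H ℤₚ.≟ m) (+ numEdges G ℤₚ.≟ m - + k)
  where
  +-k-k : ∀ i j → i + j - j ≡ i
  +-k-k = solve-∀
  -k+k : ∀ i j → i - j + j ≡ i
  -k+k = solve-∀
  eH′ : + numEdges H ≡ + numEdges G + + k
  eH′ = trans (cong +_ eH) (ℤₚ.pos-+ (numEdges G) k)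
  to : + numEdges H ≡ m → + numEdges G ≡ m - + k
  to eq = trans (sym (+-k-k (+ numEdges G) (+ k))) (cong (_- + k) (trans (sym eH′) eq))
  from : + numEdges G ≡ m - + k → + numEdges H ≡ m
  from eq = trans eH′ (trans (cong (_+ + k) eq) (-k+k m (+ k)))

count-grow : ∀ (G : Graph n) m → count (hasEdges m) (grow G)
  ≡ n ℕ.* indicator (hasEdges (m - + 1) G) ℕ.+ numEdges G ℕ.* indicator (hasEdges (m - + 2) G)
count-grow {n} G m = begin
  count (hasEdges m) (map viaVertex (allFin n) ++ map viaEdge (edges G))
    ≡⟨ count-++ (hasEdges m) (map viaVertex (allFin n)) _ ⟩
  count (hasEdges m) (map viaVertex (allFin n)) ℕ.+ count (hasEdges m) (map viaEdge (edges G))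
    ≡⟨ cong₂ ℕ._+_ (count-map (hasEdges m) viaVertex (allFin n)) (count-map (hasEdges m) viaEdge (edges G)) ⟩
  count (hasEdges m ∘ viaVertex) (allFin n) ℕ.+ count (hasEdges m ∘ viaEdge) (edges G)
    ≡⟨ cong₂ ℕ._+_ (count-const _ (allFin n) (All.tabulate (λ {v} _ → vertexChild v)))
                   (count-const _ (edges G) (All.map edgeChild (edges-ordered G))) ⟩
  length (allFin n) ℕ.* indicator (hasEdges (m - + 1) G) ℕ.+ numEdges G ℕ.* indicator (hasEdges (m - + 2) G)
    ≡⟨ cong (λ l → l ℕ.* indicator (hasEdges (m - + 1) G) ℕ.+ numEdges G ℕ.* indicator (hasEdges (m - + 2) G))
            (length-tabulate {n = n} (λ i → i)) ⟩
  n ℕ.* indicator (hasEdges (m - + 1) G) ℕ.+ numEdges G ℕ.* indicator (hasEdges (m - + 2) G)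
    ∎
  where
  open ≡-Reasoning
  viaVertex = λ v → addVertex G (single v)
  viaEdge   = λ (e : Fin n × Fin n) → addVertex G (pair (proj₁ e) (proj₂ e))
  vertexChild : ∀ v → hasEdges m (viaVertex v) ≡ hasEdges (m - + 1) G
  vertexChild v = hasEdges-shift G (viaVertex v) 1 m
    (trans (numEdges-addVertex G (single v)) (cong (numEdges G ℕ.+_) (size-single v)))
  edgeChild : ∀ {e} → Ordered e → hasEdges m (viaEdge e) ≡ hasEdges (m - + 2) G
  edgeChild {i , j} i<j = hasEdges-shift G (viaEdge (i , j)) 2 m
    (trans (numEdges-addVertex G (pair i j)) (cong (numEdges G ℕ.+_) (size-pair (<⇒≢ i<j))))

numEdges*indicator : ∀ (G : Graph n) m → + (numEdges G ℕ.* indicator (hasEdges m G)) ≡ m * + indicator (hasEdges m G)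
numEdges*indicator G m with + numEdges G ℤₚ.≟ m
... | yes refl = ℤₚ.pos-* (numEdges G) 1
... | no  _    = trans (cong +_ (ℕₚ.*-zeroʳ (numEdges G))) (sym (ℤₚ.*-zeroʳ m))

count-concatMap-grow : ∀ (L : List (Graph n)) m → + count (hasEdges m) (concatMap grow L)
  ≡ + n * + count (hasEdges (m - + 1)) L + (m - + 2) * + count (hasEdges (m - + 2)) L
count-concatMap-grow {n} []      m = sym (cong₂ _+_ (ℤₚ.*-zeroʳ (+ n)) (ℤₚ.*-zeroʳ (m - + 2)))
count-concatMap-grow {n} (G ∷ L) m = begin
  + count (hasEdges m) (grow G ++ concatMap grow L)
    ≡⟨ cong +_ (count-++ (hasEdges m) (grow G) _) ⟩
  + (count (hasEdges m) (grow G) ℕ.+ count (hasEdges m) (concatMap grow L))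
    ≡⟨ ℤₚ.pos-+ (count (hasEdges m) (grow G)) _ ⟩
  + count (hasEdges m) (grow G) + + count (hasEdges m) (concatMap grow L)
    ≡⟨ cong₂ _+_ fromG (count-concatMap-grow L m) ⟩
  (+ n * + x + (m - + 2) * + y) + (+ n * + X + (m - + 2) * + Y)
    ≡⟨ regroup (+ n) (m - + 2) (+ x) (+ y) (+ X) (+ Y) ⟩
  + n * (+ x + + X) + (m - + 2) * (+ y + + Y)
    ≡⟨ cong₂ (λ u v → + n * u + (m - + 2) * v) (ℤₚ.pos-+ x X) (ℤₚ.pos-+ y Y) ⟨
  + n * + count (hasEdges (m - + 1)) (G ∷ L) + (m - + 2) * + count (hasEdges (m - + 2)) (G ∷ L)
    ∎
  where
  open ≡-Reasoning
  x = indicator (hasEdges (m - + 1) G)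
  y = indicator (hasEdges (m - + 2) G)
  X = count (hasEdges (m - + 1)) L
  Y = count (hasEdges (m - + 2)) L
  regroup : ∀ a b x y X Y → (a * x + b * y) + (a * X + b * Y) ≡ a * (x + X) + b * (y + Y)
  regroup = solve-∀
  fromG : + count (hasEdges m) (grow G) ≡ + n * + x + (m - + 2) * + y
  fromG = begin
    + count (hasEdges m) (grow G)                     ≡⟨ cong +_ (count-grow G m) ⟩
    + (n ℕ.* x ℕ.+ numEdges G ℕ.* y)                  ≡⟨ ℤₚ.pos-+ (n ℕ.* x) _ ⟩
    + (n ℕ.* x) + + (numEdges G ℕ.* y)                ≡⟨ cong₂ _+_ (ℤₚ.pos-* n x) (numEdges*indicator G (m - + 2)) ⟩
    + n * + x + (m - + 2) * + y                       ∎

proposition1 : (c 1 (+ 0) ≡ 1 × (∀ (k : ℤ) → k ≢ + 0 → c 1 k ≡ 0))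
    × (∀ (n : ℕ) → 2 ≤ n → ∀ (m : ℤ) →
        + c n m ≡ (+ (n ∸ 1)) * (+ c (n ∸ 1) (m - + 1)) + (m - + 2) * (+ c (n ∸ 1) (m - + 2)))
proposition1 = (refl , c₁≢0) , recurrence
  where
  c₁≢0 : ∀ k → k ≢ + 0 → c 1 k ≡ 0
  c₁≢0 k k≢0 = cong length (filter-reject (λ G → + numEdges G ℤₚ.≟ k) (k≢0 ∘ sym))
  recurrence : ∀ n → 2 ≤ n → ∀ m →
    + c n m ≡ + (n ∸ 1) * + c (n ∸ 1) (m - + 1) + (m - + 2) * + c (n ∸ 1) (m - + 2)
  recurrence (suc (suc n)) (s≤s (s≤s z≤n)) m rewrite c≡count (suc (suc n)) m
    | c≡count (suc n) (m - + 1) | c≡count (suc n) (m - + 2) =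
    count-concatMap-grow (incTreesRaw (suc n)) m
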